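{- Let $s^1,s^2$ be two related strings of length $n$ over a finite alphabet $\Sigma$. For every feasible solution $y$ of the linear program $\mathrm{LP}_{\mathrm{cs}}$ there exists a feasible solution $x$ of the linear program $\mathrm{LP}_{\mathrm{cb}}$ with $\pi(x)=y$. Here $\pi$ is the map defined by $$\pi(x)^1_{t,k}=\sum_{b\in B:\ t_b=t,\ k^1_b=k}x_b,\qquad \pi(x)^2_{t,k}=\sum_{b\in B:\ t_b=t,\ k^2_b=k}x_b.$$ Thus the feasible region of $\mathrm{LP}_{\mathrm{cs}}$ is contained in the image under $\pi$ of the feasible region of $\mathrm{LP}_{\mathrm{cb}}$.
   Context: Two strings $s^1,s^2$ over $\Sigma$ are related if every letter occurs the same number of times in each; in particular both have the same length $n$. Positions are numbered $1,\dots,n$. A common block is a triple $b=(t_b,k^1_b,k^2_b)$, where $t_b$ is a nonempty string that occurs as a substring of $s^1$ starting at position $k^1_b$ and as a substring of $s^2$ starting at position $k^2_b$. Let $B$ be the set of all common blocks. $\mathrm{LP}_{\mathrm{cb}}$ has real variables $x_b$ for $b\in B$. It minimizes $\sum_{b\in B}x_b$ subject to: - $\sum_{b\in B:\ k^1_b\le j<k^1_b+|t_b|} x_b=1$ for $j=1,\dots,n$; - $\sum_{b\in B:\ k^2_b\le j<k^2_b+|t_b|} x_b=1$ for $j=1,\dots,n$; - $0\le x_b\le 1$ for all $b\in B$. Let $T$ be the set of distinct nonempty strings that occur as substrings of both $s^1$ and $s^2$. For $t\in T$ and $i\in\{1,2\}$, let $Q^i_t\subseteq\{1,\dots,n\}$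 be the set of starting positions of occurrences of $t$ in $s^i$. $\mathrm{LP}_{\mathrm{cs}}$ has real variables $y^1_{t,k}$ for $t\in T,\ k\in Q^1_t$, and $y^2_{t,k}$ for $t\in T,\ k\in Q^2_t$. It minimizes $\sum_{t\in T}\sum_{k\in Q^1_t}y^1_{t,k}$ subject to: - $\sum_{t\in T}\sum_{k\in Q^i_t:\ k\le j<k+|t|} y^i_{t,k}=1$ for $i=1,2$ and $j=1,\dots,n$; - $\sum_{k\in Q^1_t}y^1_{t,k}=\sum_{k\in Q^2_t}y^2_{t,k}$ for all $t\in T$; - all variables lie in $[0,1]$.
   Formalization: The feasible solutions $y$ of $\mathrm{LP}_{\mathrm{cs}}$ have rational rather than real values, and the solution $x$ of $\mathrm{LP}_{\mathrm{cb}}$ is taken in the rationals as well. -}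

module Defs where

open import Data.Nat as ℕ using (ℕ; zero; suc; _∸_; _≤ᵇ_; _<ᵇ_; _≡ᵇ_)
open import Data.Bool using (Bool; true; false; _∧_; not; if_then_else_)
open import Data.Fin using (Fin)
import Data.Fin as Fin
open import Data.List using (List; []; _∷_; length; take; drop; filter; map; upTo; foldr; null)
open import Data.Bool.ListAction using (any)
open import Data.List.Properties using (≡-dec)
open import Data.Rational using (ℚ; 0ℚ; 1ℚ; _+_; _≤_)
open import Data.Product using (_×_; ∃)
open import Relation.Nullary.Decidable using (⌊_⌋)
open import Relation.Binary.PropositionalEquality using (_≡_)

Str : ℕ → Set
Str σ = List (Fin σ)

_≟s_ : ∀ {σ} (u v : Str σ) → _
_≟s_ = ≡-dec Fin._≟_

count : ∀ {σ} → Fin σ → Str σ → ℕ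
count a s = length (filter (λ c → c Fin.≟ a) s)

Related : ∀ {σ} → Str σ → Str σ → Set
Related {σ} s₁ s₂ = ∀ (a : Fin σ) → count a s₁ ≡ count a s₂

pos : ℕ → List ℕ
pos n = map suc (upTo n)

sumℚ : List ℚ → ℚ
sumℚ = foldr _+_ 0ℚ

Σ[1…_] : ℕ → (ℕ → ℚ) → ℚ
Σ[1… n ] f = sumℚ (map f (pos n))

-- substring of s of length ℓ starting at (1-based) position k
sub : ∀ {σ} → Str σ → ℕ → ℕ → Str σ
sub s k ℓ = take ℓ (drop (k ∸ 1) s)

occ : ∀ {σ} → Str σ → ℕ → ℕ → Bool
occ s k ℓ = (1 ≤ᵇ k) ∧ (1 ≤ᵇ ℓ) ∧ ((k ∸ 1) ℕ.+ ℓ ≤ᵇ length s)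

isAt : ∀ {σ} → Str σ → Str σ → ℕ → Bool
isAt s t k = occ s k (length t) ∧ ⌊ sub s k (length t) ≟s t ⌋

occurs : ∀ {σ} → Str σ → Str σ → Bool
occurs s t = any (isAt s t) (pos (length s))

inT : ∀ {σ} → Str σ → Str σ → Str σ → Bool
inT s₁ s₂ t = not (null t) ∧ occurs s₁ t ∧ occurs s₂ t

covers : ℕ → ℕ → ℕ → Bool
covers j k ℓ = (k ≤ᵇ j) ∧ (j <ᵇ k ℕ.+ ℓ)

-- Common blocks.  A block b = (t_b, k¹_b, k²_b) is encoded by the triple
-- (k¹_b, k²_b, ℓ) with ℓ = |t_b| (t_b = sub s¹ k¹_b ℓ is determined).

isBlock : ∀ {σ} → Str σ → Str σ → ℕ → ℕ → ℕ → Bool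
isBlock s₁ s₂ k₁ k₂ ℓ = occ s₁ k₁ ℓ ∧ occ s₂ k₂ ℓ ∧ ⌊ sub s₁ k₁ ℓ ≟s sub s₂ k₂ ℓ ⌋

sumB : ∀ {σ} → Str σ → Str σ → (ℕ → ℕ → ℕ → ℚ) → ℚ
sumB s₁ s₂ f =
  Σ[1… length s₁ ] λ k₁ → Σ[1… length s₁ ] λ k₂ → Σ[1… length s₁ ] λ ℓ →
    if isBlock s₁ s₂ k₁ k₂ ℓ then f k₁ k₂ ℓ else 0ℚ

-- feasible solutions of LP_cb (x_b = x k¹ k² ℓ; values off B are irrelevant)
FeasibleCB : ∀ {σ} → Str σ → Str σ → (ℕ → ℕ → ℕ → ℚ) → Set
FeasibleCB s₁ s₂ x =
  (∀ j → 1 ℕ.≤ j → j ℕ.≤ length s₁ →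
     sumB s₁ s₂ (λ k₁ k₂ ℓ → if covers j k₁ ℓ then x k₁ k₂ ℓ else 0ℚ) ≡ 1ℚ) ×
  (∀ j → 1 ℕ.≤ j → j ℕ.≤ length s₁ →
     sumB s₁ s₂ (λ k₁ k₂ ℓ → if covers j k₂ ℓ then x k₁ k₂ ℓ else 0ℚ) ≡ 1ℚ) ×
  (∀ k₁ k₂ ℓ → isBlock s₁ s₂ k₁ k₂ ℓ ≡ true → (0ℚ ≤ x k₁ k₂ ℓ) × (x k₁ k₂ ℓ ≤ 1ℚ))

-- LP_cs.  yⁱ_{t,k} = yᵢ t k, meaningful for t ∈ T, k ∈ Qⁱ_t.

-- Σ_{t∈T} Σ_{k∈Qⁱ_t, k ≤ j < k+|t|} yⁱ_{t,k}, indexing the pair (t,k) by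
-- the occurrence (k, |t|) in s = sⁱ (so t = sub s k |t|).
coverCS : ∀ {σ} → Str σ → Str σ → Str σ → (Str σ → ℕ → ℚ) → ℕ → ℚ
coverCS s₁ s₂ s y j =
  Σ[1… length s ] λ k → Σ[1… length s ] λ ℓ →
    if occ s k ℓ ∧ inT s₁ s₂ (sub s k ℓ) ∧ covers j k ℓ then y (sub s k ℓ) k else 0ℚ

sumQ : ∀ {σ} → Str σ → Str σ → (Str σ → ℕ → ℚ) → ℚ
sumQ s t y = Σ[1… length s ] λ k → if isAt s t k then y t k else 0ℚ

FeasibleCS : ∀ {σ} → Str σ → Str σ → (Str σ → ℕ → ℚ) → (Str σ → ℕ → ℚ) → Set
FeasibleCS s₁ s₂ y₁ y₂ =
  (∀ j → 1 ℕ.≤ j → j ℕ.≤ length s₁ → coverCS s₁ s₂ s₁ y₁ j ≡ 1ℚ) ×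
  (∀ j → 1 ℕ.≤ j → j ℕ.≤ length s₁ → coverCS s₁ s₂ s₂ y₂ j ≡ 1ℚ) ×
  (∀ t → inT s₁ s₂ t ≡ true → sumQ s₁ t y₁ ≡ sumQ s₂ t y₂) ×
  (∀ t k → inT s₁ s₂ t ≡ true → isAt s₁ t k ≡ true → (0ℚ ≤ y₁ t k) × (y₁ t k ≤ 1ℚ)) ×
  (∀ t k → inT s₁ s₂ t ≡ true → isAt s₂ t k ≡ true → (0ℚ ≤ y₂ t k) × (y₂ t k ≤ 1ℚ))

π₁ : ∀ {σ} → Str σ → Str σ → (ℕ → ℕ → ℕ → ℚ) → Str σ → ℕ → ℚ
π₁ s₁ s₂ x t k =
  sumB s₁ s₂ (λ k₁ k₂ ℓ → if ⌊ sub s₁ k₁ ℓ ≟s t ⌋ ∧ (k₁ ≡ᵇ k) then x k₁ k₂ ℓ else 0ℚ)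

π₂ : ∀ {σ} → Str σ → Str σ → (ℕ → ℕ → ℕ → ℚ) → Str σ → ℕ → ℚ
π₂ s₁ s₂ x t k =
  sumB s₁ s₂ (λ k₁ k₂ ℓ → if ⌊ sub s₁ k₁ ℓ ≟s t ⌋ ∧ (k₂ ≡ᵇ k) then x k₁ k₂ ℓ else 0ℚ)

{-# OPTIONS --safe #-}

-- For t ∈ T let S(t) = Σₖ y¹_{t,k}, which equals Σₖ y²_{t,k} by the second constraint of LP_cs.
-- Put on the block (t, k¹, k²) the product coupling  x = y¹_{t,k¹} · y²_{t,k²} / S(t)  (read as 0
-- when S(t) = 0, where all y¹_{t,·} and y²_{t,·} vanish by nonnegativity).  Summing over k² gives
-- back y¹_{t,k¹} and summing over k¹ gives back y²_{t,k²}; this is π(x) = y, and regrouping the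
-- covering sums of LP_cb by (k¹, |t|) resp. (k², |t|) turns them into those of LP_cs.  Finally
-- 0 ≤ x ≤ y¹_{t,k¹} ≤ 1 since y²_{t,k²} ≤ S(t).

module Submission where

open import Defs
open import Data.Nat using (ℕ)
open import Data.Rational using (ℚ)
open import Data.Bool using (true)
open import Data.Product using (_×_; ∃)
open import Relation.Binary.PropositionalEquality using (_≡_)

open import Algebra.Bundles using (CommutativeMonoid)
import Algebra.Properties.CommutativeMonoid.Sum as CommutativeMonoidSum
import Algebra.Properties.CommutativeSemigroup as CommutativeSemigroupProperties
open import Data.Bool using (Bool; false; _∧_; not; if_then_else_)
open import Data.Bool.Properties
  using (T-≡; ∧-conicalˡ; ∧-conicalʳ; ∧-zeroʳ; ∧-identityʳ; if-∧; if-eta; if-swap-then)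
import Data.Fin as Fin
open import Data.Fin using (Fin)
open import Data.List using (List; []; _∷_; length; map; null; take; drop)
open import Data.List.Properties using (length-take; length-drop)
open import Data.List.Membership.Propositional using (_∈_; lose)
open import Data.List.Membership.Propositional.Properties using (∈-map⁺; ∈-upTo⁺)
open import Data.List.Relation.Unary.All as All using (All; []; _∷_)
open import Data.List.Relation.Unary.AllPairs using ([]; _∷_)
open import Data.List.Relation.Unary.Any using (here; there)
open import Data.List.Relation.Unary.Any.Properties using (any⁺)
open import Data.List.Relation.Unary.Unique.Propositional using (Unique)
import Data.List.Relation.Unary.Unique.Propositional.Properties as Unique
open import Data.Nat as ℕ using (suc; z≤n; s≤s; _∸_; _≡ᵇ_)
import Data.Nat.Properties as ℕ
open import Data.Rational as ℚ using (0ℚ; 1ℚ; _+_; _*_; 1/_; _≤_)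
import Data.Rational.Properties as ℚ
open import Data.Product using (_,_; proj₁; proj₂)
open import Function.Bundles using (Equivalence; mk⇔)
open import Relation.Binary.PropositionalEquality
  using (_≢_; refl; sym; trans; cong; cong₂; subst; module ≡-Reasoning)
open import Relation.Nullary.Decidable
  using (Dec; does; yes; no; ⌊_⌋; toWitness; isYes≗does; dec-true; dec-false; does-⇔)

private
  variable
    σ : ℕ

if-true : ∀ {A : Set} {b} {u v : A} → b ≡ true → (if b then u else v) ≡ u
if-true refl = refl

if-cong : ∀ {A : Set} {b} {u v w : A} → (b ≡ true → u ≡ v) →
          (if b then u else w) ≡ (if b then v else w)
if-cong {b = true}  u≡v = u≡v refl
if-cong {b = false} _   = refl

if-float₀ : ∀ (f : ℚ → ℚ) → f 0ℚ ≡ 0ℚ → ∀ b {v} →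
            (if b then f v else 0ℚ) ≡ f (if b then v else 0ℚ)
if-float₀ f f0≡0 true  = refl
if-float₀ f f0≡0 false = sym f0≡0

if-∧-swap : ∀ {A : Set} a b c d {v w : A} →
            (if a ∧ b ∧ c then (if d then v else w) else w) ≡
            (if a ∧ b ∧ d then (if c then v else w) else w)
if-∧-swap false b     c d = refl
if-∧-swap true  false c d = refl
if-∧-swap true  true  c d = if-swap-then c d

if-∧-float : ∀ {A : Set} a b c {v w : A} →
             (if a then (if b ∧ c then v else w) else w) ≡
             (if c then (if a ∧ b then v else w) else w)
if-∧-float false b c = sym (if-eta c)
if-∧-float true  b c = trans (if-∧ b) (if-swap-then b c)

∧³-true : ∀ a b {c} → a ∧ b ∧ c ≡ true → a ≡ true × b ≡ true × c ≡ true
∧³-true true true c≡true = refl , refl , c≡true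

≡-∧-implied : ∀ {a b} → (b ≡ true → a ≡ true) → b ≡ a ∧ b
≡-∧-implied {a} {false} _   = sym (∧-zeroʳ a)
≡-∧-implied {a} {true}  b⇒a = sym (cong (_∧ true) (b⇒a refl))

⌊⌋-true : ∀ {A : Set} (a? : Dec A) → A → ⌊ a? ⌋ ≡ true
⌊⌋-true a? a = trans (isYes≗does a?) (dec-true a? a)

⇔-true⇒≡ : ∀ {a b} → (a ≡ true → b ≡ true) → (b ≡ true → a ≡ true) → a ≡ b
⇔-true⇒≡ {true}          a⇒b _   = sym (a⇒b refl)
⇔-true⇒≡ {false} {true}  _   b⇒a = b⇒a refl
⇔-true⇒≡ {false} {false} _   _   = refl

-- Finite sums of rationals indexed by lists of naturals

∑ : List ℕ → (ℕ → ℚ) → ℚ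
∑ xs f = sumℚ (map f xs)

∑-cong : ∀ xs {f g : ℕ → ℚ} → (∀ i → f i ≡ g i) → ∑ xs f ≡ ∑ xs g
∑-cong []       f≗g = refl
∑-cong (x ∷ xs) f≗g = cong₂ _+_ (f≗g x) (∑-cong xs f≗g)

∑-zero : ∀ {xs} {f : ℕ → ℚ} → All (λ i → f i ≡ 0ℚ) xs → ∑ xs f ≡ 0ℚ
∑-zero []             = refl
∑-zero (fx≡0 ∷ fxs≡0) = cong₂ _+_ fx≡0 (∑-zero fxs≡0)

∑-distrib-+ : ∀ xs (f g : ℕ → ℚ) → ∑ xs (λ i → f i + g i) ≡ ∑ xs f + ∑ xs g
∑-distrib-+ []       f g = refl
∑-distrib-+ (x ∷ xs) f g =
  trans (cong (f x + g x +_) (∑-distrib-+ xs f g))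
        (interchange (f x) (g x) (∑ xs f) (∑ xs g))
  where open CommutativeSemigroupProperties
               (CommutativeMonoid.commutativeSemigroup ℚ.+-0-commutativeMonoid)

∑-comm : ∀ xs ys (f : ℕ → ℕ → ℚ) →
         ∑ xs (λ i → ∑ ys (f i)) ≡ ∑ ys (λ j → ∑ xs (λ i → f i j))
∑-comm []       ys f = sym (∑-zero (All.universal (λ _ → refl) ys))
∑-comm (x ∷ xs) ys f =
  trans (cong (∑ ys (f x) +_) (∑-comm xs ys f))
        (sym (∑-distrib-+ ys (f x) (λ j → ∑ xs (λ i → f i j))))

*-distribˡ-∑ : ∀ xs c (f : ℕ → ℚ) → c * ∑ xs f ≡ ∑ xs (λ i → c * f i)
*-distribˡ-∑ []       c f = ℚ.*-zeroʳ c
*-distribˡ-∑ (x ∷ xs) c f =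
  trans (ℚ.*-distribˡ-+ c (f x) (∑ xs f)) (cong (c * f x +_) (*-distribˡ-∑ xs c f))

*-distribʳ-∑ : ∀ xs c (f : ℕ → ℚ) → ∑ xs f * c ≡ ∑ xs (λ i → f i * c)
*-distribʳ-∑ []       c f = ℚ.*-zeroˡ c
*-distribʳ-∑ (x ∷ xs) c f =
  trans (ℚ.*-distribʳ-+ c (f x) (∑ xs f)) (cong (f x * c +_) (*-distribʳ-∑ xs c f))

∑-if : ∀ xs b (f : ℕ → ℚ) → ∑ xs (λ i → if b then f i else 0ℚ) ≡ (if b then ∑ xs f else 0ℚ)
∑-if xs true  f = refl
∑-if xs false f = ∑-zero (All.universal (λ _ → refl) xs)

∑-≡ᵇ : ∀ {xs k} (f : ℕ → ℚ) → Unique xs → k ∈ xs →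
       ∑ xs (λ i → if i ≡ᵇ k then f i else 0ℚ) ≡ f k
∑-≡ᵇ {x ∷ xs} f (x∉xs ∷ _) (here refl) =
  begin
    (if x ≡ᵇ x then f x else 0ℚ) + ∑ xs (λ i → if i ≡ᵇ x then f i else 0ℚ)
      ≡⟨ cong₂ _+_ (if-true (dec-true (x ℕ.≟ x) refl)) (∑-zero (All.map off x∉xs)) ⟩
    f x + 0ℚ
      ≡⟨ ℚ.+-identityʳ (f x) ⟩
    f x
  ∎
  where
  open ≡-Reasoning
  off : ∀ {i} → x ≢ i → (if i ≡ᵇ x then f i else 0ℚ) ≡ 0ℚ
  off {i} x≢i = cong (λ b → if b then f i else 0ℚ) (dec-false (i ℕ.≟ x) (λ i≡x → x≢i (sym i≡x)))
∑-≡ᵇ {x ∷ xs} {k} f (x∉xs ∷ uniq) (there k∈xs) =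
  begin
    (if x ≡ᵇ k then f x else 0ℚ) + ∑ xs (λ i → if i ≡ᵇ k then f i else 0ℚ)
      ≡⟨ cong₂ _+_ (cong (λ b → if b then f x else 0ℚ) (dec-false (x ℕ.≟ k) (All.lookup x∉xs k∈xs)))
                   (∑-≡ᵇ f uniq k∈xs) ⟩
    0ℚ + f k
      ≡⟨ ℚ.+-identityˡ (f k) ⟩
    f k
  ∎
  where open ≡-Reasoning

∑-nonNeg : ∀ xs {f : ℕ → ℚ} → (∀ i → 0ℚ ≤ f i) → 0ℚ ≤ ∑ xs f
∑-nonNeg []       f≥0 = ℚ.≤-refl
∑-nonNeg (x ∷ xs) f≥0 = ℚ.+-mono-≤ (f≥0 x) (∑-nonNeg xs f≥0)

∈⇒≤∑ : ∀ {xs i} {f : ℕ → ℚ} → (∀ j → 0ℚ ≤ f j) → i ∈ xs → f i ≤ ∑ xs f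
∈⇒≤∑ {x ∷ xs} {f = f} f≥0 (here refl) = begin
  f x            ≡⟨ ℚ.+-identityʳ (f x) ⟨
  f x + 0ℚ       ≤⟨ ℚ.+-monoʳ-≤ (f x) (∑-nonNeg xs f≥0) ⟩
  f x + ∑ xs f   ∎
  where open ℚ.≤-Reasoning
∈⇒≤∑ {x ∷ xs} {i} {f} f≥0 (there i∈xs) = begin
  f i            ≡⟨ ℚ.+-identityˡ (f i) ⟨
  0ℚ + f i       ≤⟨ ℚ.+-mono-≤ (f≥0 x) (∈⇒≤∑ f≥0 i∈xs) ⟩
  f x + ∑ xs f   ∎
  where open ℚ.≤-Reasoning

∑≡0⇒≡0 : ∀ {xs i} {f : ℕ → ℚ} → (∀ j → 0ℚ ≤ f j) → i ∈ xs → ∑ xs f ≡ 0ℚ → f i ≡ 0ℚ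
∑≡0⇒≡0 f≥0 i∈xs ∑≡0 = ℚ.≤-antisym (subst (_ ≤_) ∑≡0 (∈⇒≤∑ f≥0 i∈xs)) (f≥0 _)

-- The product coupling of two weight vectors of equal mass

inv₀ : ℚ → ℚ
inv₀ q with q ℚ.≟ 0ℚ
... | yes _   = 0ℚ
... | no q≢0 = (1/ q) {{ℚ.≢-nonZero q≢0}}

*-inv₀-cancelʳ : ∀ a q → (q ≡ 0ℚ → a ≡ 0ℚ) → a * q * inv₀ q ≡ a
*-inv₀-cancelʳ a q q≡0⇒a≡0 with q ℚ.≟ 0ℚ
... | yes q≡0 = trans (ℚ.*-zeroʳ (a * q)) (sym (q≡0⇒a≡0 q≡0))
... | no q≢0 = begin
  a * q * 1/ q     ≡⟨ ℚ.*-assoc a q (1/ q) ⟩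
  a * (q * 1/ q)   ≡⟨ cong (a *_) (ℚ.*-inverseʳ q) ⟩
  a * 1ℚ           ≡⟨ ℚ.*-identityʳ a ⟩
  a                ∎
  where
  open ≡-Reasoning
  instance _ = ℚ.≢-nonZero q≢0

-- The NonZero instance is abstracted so that 1/ q matches whatever proof the caller's term carries.
1/-nonNeg : ∀ q .{{_ : ℚ.Positive q}} .{{_ : ℚ.NonZero q}} → 0ℚ ≤ 1/ q
1/-nonNeg q = ℚ.nonNegative⁻¹ ((1/ q) {{ℚ.pos⇒nonZero q}})
                {{ℚ.pos⇒nonNeg ((1/ q) {{ℚ.pos⇒nonZero q}}) {{ℚ.1/pos⇒pos q}}}}

nonNeg∧≢0⇒pos : ∀ {q} → 0ℚ ≤ q → q ≢ 0ℚ → ℚ.Positive q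
nonNeg∧≢0⇒pos {q} q≥0 q≢0 = ℚ.nonNeg∧nonZero⇒pos q {{ℚ.nonNegative q≥0}} {{ℚ.≢-nonZero q≢0}}

inv₀-nonNeg : ∀ {q} → 0ℚ ≤ q → 0ℚ ≤ inv₀ q
inv₀-nonNeg {q} q≥0 with q ℚ.≟ 0ℚ
... | yes _   = ℚ.≤-refl
... | no q≢0 = 1/-nonNeg q {{nonNeg∧≢0⇒pos q≥0 q≢0}} {{ℚ.≢-nonZero q≢0}}

*-inv₀-≤-1 : ∀ {b q} → 0ℚ ≤ b → b ≤ q → b * inv₀ q ≤ 1ℚ
*-inv₀-≤-1 {b} {q} b≥0 b≤q with q ℚ.≟ 0ℚ
... | yes _   = subst (_≤ 1ℚ) (sym (ℚ.*-zeroʳ b)) (ℚ.nonNegative⁻¹ 1ℚ)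
... | no q≢0 = begin
  b * 1/ q   ≤⟨ ℚ.*-monoʳ-≤-nonNeg (1/ q) {{ℚ.nonNegative (1/-nonNeg q)}} b≤q ⟩
  q * 1/ q   ≡⟨ ℚ.*-inverseʳ q ⟩
  1ℚ         ∎
  where
  open ℚ.≤-Reasoning
  instance
    _ = nonNeg∧≢0⇒pos (ℚ.≤-trans b≥0 b≤q) q≢0
    _ = ℚ.≢-nonZero q≢0

*-inv₀-bounds : ∀ {p q m} → 0ℚ ≤ p → p ≤ 1ℚ → 0ℚ ≤ q → q ≤ m →
                0ℚ ≤ p * q * inv₀ m × p * q * inv₀ m ≤ 1ℚ
*-inv₀-bounds {p} {q} {m} p≥0 p≤1 q≥0 q≤m = lower , upper
  where
  instance
    _ = ℚ.nonNegative p≥0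
    _ = ℚ.nonNegative q≥0
    _ = ℚ.nonNegative (inv₀-nonNeg (ℚ.≤-trans q≥0 q≤m))
  lower : 0ℚ ≤ p * q * inv₀ m
  lower = ℚ.nonNegative⁻¹ _ {{ℚ.nonNeg*nonNeg⇒nonNeg (p * q) {{ℚ.nonNeg*nonNeg⇒nonNeg p q}} (inv₀ m)}}
  upper : p * q * inv₀ m ≤ 1ℚ
  upper = begin
    p * q * inv₀ m     ≡⟨ ℚ.*-assoc p q (inv₀ m) ⟩
    p * (q * inv₀ m)   ≤⟨ ℚ.*-monoˡ-≤-nonNeg p (*-inv₀-≤-1 q≥0 q≤m) ⟩
    p * 1ℚ             ≡⟨ ℚ.*-identityʳ p ⟩
    p                  ≤⟨ p≤1 ⟩
    1ℚ                 ∎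
    where open ℚ.≤-Reasoning

coupling : (ℕ → ℚ) → (ℕ → ℚ) → ℚ → ℕ → ℕ → ℚ
coupling a b m i j = a i * b j * inv₀ m

module _ (xs : List ℕ) (a b : ℕ → ℚ) (m : ℚ) where

  ∑-coupling-row : ∀ (q : ℕ → Bool) i → ∑ xs (λ j → if q j then b j else 0ℚ) ≡ m →
                   (m ≡ 0ℚ → a i ≡ 0ℚ) →
                   ∑ xs (λ j → if q j then coupling a b m i j else 0ℚ) ≡ a i
  ∑-coupling-row q i ∑b≡m m≡0⇒aᵢ≡0 = begin
    ∑ xs (λ j → if q j then a i * b j * inv₀ m else 0ℚ)
      ≡⟨ ∑-cong xs (λ j → if-float₀ (λ v → a i * v * inv₀ m) ai*0*r≡0 (q j)) ⟩
    ∑ xs (λ j → a i * B j * inv₀ m)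
      ≡⟨ *-distribʳ-∑ xs (inv₀ m) (λ j → a i * B j) ⟨
    ∑ xs (λ j → a i * B j) * inv₀ m
      ≡⟨ cong (_* inv₀ m) (*-distribˡ-∑ xs (a i) B) ⟨
    a i * ∑ xs B * inv₀ m
      ≡⟨ cong (λ s → a i * s * inv₀ m) ∑b≡m ⟩
    a i * m * inv₀ m
      ≡⟨ *-inv₀-cancelʳ (a i) m m≡0⇒aᵢ≡0 ⟩
    a i
    ∎
    where
    open ≡-Reasoning
    B : ℕ → ℚ
    B j = if q j then b j else 0ℚ
    ai*0*r≡0 : a i * 0ℚ * inv₀ m ≡ 0ℚ
    ai*0*r≡0 = trans (cong (_* inv₀ m) (ℚ.*-zeroʳ (a i))) (ℚ.*-zeroˡ (inv₀ m))

  ∑-coupling-col : ∀ (p : ℕ → Bool) j → ∑ xs (λ i → if p i then a i else 0ℚ) ≡ m →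
                   (m ≡ 0ℚ → b j ≡ 0ℚ) →
                   ∑ xs (λ i → if p i then coupling a b m i j else 0ℚ) ≡ b j
  ∑-coupling-col p j ∑a≡m m≡0⇒bⱼ≡0 = begin
    ∑ xs (λ i → if p i then a i * b j * inv₀ m else 0ℚ)
      ≡⟨ ∑-cong xs (λ i → if-float₀ (λ v → v * b j * inv₀ m) 0*bj*r≡0 (p i)) ⟩
    ∑ xs (λ i → A i * b j * inv₀ m)
      ≡⟨ *-distribʳ-∑ xs (inv₀ m) (λ i → A i * b j) ⟨
    ∑ xs (λ i → A i * b j) * inv₀ m
      ≡⟨ cong (_* inv₀ m) (*-distribʳ-∑ xs (b j) A) ⟨
    ∑ xs A * b j * inv₀ m
      ≡⟨ cong (λ s → s * b j * inv₀ m) ∑a≡m ⟩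
    m * b j * inv₀ m
      ≡⟨ cong (_* inv₀ m) (ℚ.*-comm m (b j)) ⟩
    b j * m * inv₀ m
      ≡⟨ *-inv₀-cancelʳ (b j) m m≡0⇒bⱼ≡0 ⟩
    b j
    ∎
    where
    open ≡-Reasoning
    A : ℕ → ℚ
    A i = if p i then a i else 0ℚ
    0*bj*r≡0 : 0ℚ * b j * inv₀ m ≡ 0ℚ
    0*bj*r≡0 = trans (cong (_* inv₀ m) (ℚ.*-zeroˡ (b j))) (ℚ.*-zeroˡ (inv₀ m))

pos-unique : ∀ n → Unique (pos n)
pos-unique n = Unique.map⁺ ℕ.suc-injective (Unique.upTo⁺ n)

∈-pos : ∀ {k n} → 1 ℕ.≤ k → k ℕ.≤ n → k ∈ pos n
∈-pos {suc k} (s≤s z≤n) k<n = ∈-map⁺ suc (∈-upTo⁺ k<n)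

≤ᵇ-true⇒≤ : ∀ {m n} → (m ℕ.≤ᵇ n) ≡ true → m ℕ.≤ n
≤ᵇ-true⇒≤ {m} {n} e = ℕ.≤ᵇ⇒≤ m n (Equivalence.from T-≡ e)

occ⁻ : ∀ (s : Str σ) k ℓ → occ s k ℓ ≡ true →
       1 ℕ.≤ k × 1 ℕ.≤ ℓ × (k ∸ 1) ℕ.+ ℓ ℕ.≤ length s
occ⁻ s k ℓ o with ∧³-true (1 ℕ.≤ᵇ k) (1 ℕ.≤ᵇ ℓ) o
... | k≥1 , ℓ≥1 , fits = ≤ᵇ-true⇒≤ k≥1 , ≤ᵇ-true⇒≤ ℓ≥1 , ≤ᵇ-true⇒≤ fits

occ⇒∈pos : ∀ (s : Str σ) k ℓ → occ s k ℓ ≡ true → k ∈ pos (length s) × ℓ ∈ pos (length s)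
occ⇒∈pos s k ℓ o with occ⁻ s k ℓ o
occ⇒∈pos s (suc k) (suc ℓ) o | k≥1 , ℓ≥1 , k+ℓ≤∣s∣ =
  ∈-pos k≥1 (ℕ.<-≤-trans (ℕ.m<m+n k ℓ≥1) k+ℓ≤∣s∣) , ∈-pos ℓ≥1 (ℕ.m+n≤o⇒n≤o k k+ℓ≤∣s∣)

length-sub : ∀ (s : Str σ) k ℓ → occ s k ℓ ≡ true → length (sub s k ℓ) ≡ ℓ
length-sub s k ℓ o = begin
  length (take ℓ (drop (k ∸ 1) s))     ≡⟨ length-take ℓ (drop (k ∸ 1) s) ⟩
  ℓ ℕ.⊓ length (drop (k ∸ 1) s)        ≡⟨ cong (ℓ ℕ.⊓_) (length-drop (k ∸ 1) s) ⟩
  ℓ ℕ.⊓ (length s ∸ (k ∸ 1))           ≡⟨ ℕ.m≤n⇒m⊓n≡m ℓ≤rest ⟩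
  ℓ                                    ∎
  where
  open ≡-Reasoning
  ℓ≤rest : ℓ ℕ.≤ length s ∸ (k ∸ 1)
  ℓ≤rest = ℕ.m+n≤o⇒m≤o∸n ℓ (subst (ℕ._≤ length s) (ℕ.+-comm (k ∸ 1) ℓ) (proj₂ (proj₂ (occ⁻ s k ℓ o))))

isAt⁻ : ∀ (s t : Str σ) k → isAt s t k ≡ true → occ s k (length t) ≡ true × sub s k (length t) ≡ t
isAt⁻ s t k a = ∧-conicalˡ (occ s k (length t)) _ a
               , toWitness (Equivalence.from T-≡ (∧-conicalʳ (occ s k (length t)) _ a))

isAt-sub : ∀ (s : Str σ) k ℓ → occ s k ℓ ≡ true → ∀ s′ k′ →
           isAt s′ (sub s k ℓ) k′ ≡ occ s′ k′ ℓ ∧ ⌊ sub s′ k′ ℓ ≟s sub s k ℓ ⌋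
isAt-sub s k ℓ o s′ k′ rewrite length-sub s k ℓ o = refl

⌊≟s⌋-sym : ∀ (u v : Str σ) → ⌊ u ≟s v ⌋ ≡ ⌊ v ≟s u ⌋
⌊≟s⌋-sym u v = begin
  ⌊ u ≟s v ⌋          ≡⟨ isYes≗does (u ≟s v) ⟩
  does (u ≟s v)       ≡⟨ does-⇔ (mk⇔ sym sym) (u ≟s v) (v ≟s u) ⟩
  does (v ≟s u)       ≡⟨ isYes≗does (v ≟s u) ⟨
  ⌊ v ≟s u ⌋          ∎
  where open ≡-Reasoning

isAt-self : ∀ (s : Str σ) k ℓ → occ s k ℓ ≡ true → isAt s (sub s k ℓ) k ≡ true
isAt-self s k ℓ o = trans (isAt-sub s k ℓ o s k) (cong₂ _∧_ o (⌊⌋-true (sub s k ℓ ≟s sub s k ℓ) refl))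

isAt⇒occurs : ∀ (s t : Str σ) k → isAt s t k ≡ true → occurs s t ≡ true
isAt⇒occurs s t k a =
  Equivalence.to T-≡ (any⁺ (isAt s t) (lose (proj₁ (occ⇒∈pos s k (length t) (proj₁ (isAt⁻ s t k a))))
                                            (Equivalence.from T-≡ a)))

nonEmpty : ∀ (t : Str σ) → 1 ℕ.≤ length t → not (null t) ≡ true
nonEmpty (_ ∷ _) _ = refl

isAt⇒inT : ∀ (s₁ s₂ t : Str σ) k₁ k₂ → isAt s₁ t k₁ ≡ true → isAt s₂ t k₂ ≡ true → inT s₁ s₂ t ≡ true
isAt⇒inT s₁ s₂ t k₁ k₂ a₁ a₂ =
  cong₂ _∧_ (nonEmpty t t≢[]) (cong₂ _∧_ (isAt⇒occurs s₁ t k₁ a₁) (isAt⇒occurs s₂ t k₂ a₂))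
  where
  t≢[] : 1 ℕ.≤ length t
  t≢[] = proj₁ (proj₂ (occ⁻ s₁ k₁ (length t) (proj₁ (isAt⁻ s₁ t k₁ a₁))))

module _ (s₁ s₂ : Str σ) where

  isBlock-decomp₁ : ∀ k₁ k₂ ℓ → isBlock s₁ s₂ k₁ k₂ ℓ ≡
                    occ s₁ k₁ ℓ ∧ inT s₁ s₂ (sub s₁ k₁ ℓ) ∧ isAt s₂ (sub s₁ k₁ ℓ) k₂
  isBlock-decomp₁ k₁ k₂ ℓ with occ s₁ k₁ ℓ in o
  ... | false = refl
  ... | true  = begin
    occ s₂ k₂ ℓ ∧ ⌊ sub s₁ k₁ ℓ ≟s sub s₂ k₂ ℓ ⌋  ≡⟨ cong (occ s₂ k₂ ℓ ∧_) (⌊≟s⌋-sym _ _) ⟩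
    occ s₂ k₂ ℓ ∧ ⌊ sub s₂ k₂ ℓ ≟s sub s₁ k₁ ℓ ⌋  ≡⟨ isAt-sub s₁ k₁ ℓ o s₂ k₂ ⟨
    isAt s₂ (sub s₁ k₁ ℓ) k₂
      ≡⟨ ≡-∧-implied (isAt⇒inT s₁ s₂ _ k₁ k₂ (isAt-self s₁ k₁ ℓ o)) ⟩
    inT s₁ s₂ (sub s₁ k₁ ℓ) ∧ isAt s₂ (sub s₁ k₁ ℓ) k₂ ∎
    where open ≡-Reasoning

  isBlock-decomp₂ : ∀ k₁ k₂ ℓ → isBlock s₁ s₂ k₁ k₂ ℓ ≡
                    occ s₂ k₂ ℓ ∧ inT s₁ s₂ (sub s₂ k₂ ℓ) ∧ isAt s₁ (sub s₂ k₂ ℓ) k₁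
  isBlock-decomp₂ k₁ k₂ ℓ with occ s₂ k₂ ℓ in o
  ... | false = ∧-zeroʳ (occ s₁ k₁ ℓ)
  ... | true  = trans (sym (isAt-sub s₂ k₂ ℓ o s₁ k₁))
                      (≡-∧-implied (λ a₁ → isAt⇒inT s₁ s₂ _ k₁ k₂ a₁ (isAt-self s₂ k₂ ℓ o)))

  isBlock∧≟ : ∀ t k₁ k₂ ℓ → isBlock s₁ s₂ k₁ k₂ ℓ ∧ ⌊ sub s₁ k₁ ℓ ≟s t ⌋ ≡
              (ℓ ≡ᵇ length t) ∧ isAt s₁ t k₁ ∧ isAt s₂ t k₂
  isBlock∧≟ t k₁ k₂ ℓ = ⇔-true⇒≡ to from
    where
    to : isBlock s₁ s₂ k₁ k₂ ℓ ∧ ⌊ sub s₁ k₁ ℓ ≟s t ⌋ ≡ true →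
         (ℓ ≡ᵇ length t) ∧ isAt s₁ t k₁ ∧ isAt s₂ t k₂ ≡ true
    to h with ∧³-true (occ s₁ k₁ ℓ) (inT s₁ s₂ (sub s₁ k₁ ℓ))
                      (trans (sym (isBlock-decomp₁ k₁ k₂ ℓ)) (∧-conicalˡ (isBlock s₁ s₂ k₁ k₂ ℓ) _ h))
    ... | o , _ , a₂ = cong₂ _∧_ (dec-true (ℓ ℕ.≟ length t) ℓ≡∣t∣)
                                 (cong₂ _∧_ (subst (λ u → isAt s₁ u k₁ ≡ true) sub≡t (isAt-self s₁ k₁ ℓ o))
                                            (subst (λ u → isAt s₂ u k₂ ≡ true) sub≡t a₂))
      where
      sub≡t : sub s₁ k₁ ℓ ≡ t
      sub≡t = toWitness (Equivalence.from T-≡ (∧-conicalʳ (isBlock s₁ s₂ k₁ k₂ ℓ) _ h))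
      ℓ≡∣t∣ : ℓ ≡ length t
      ℓ≡∣t∣ = trans (sym (length-sub s₁ k₁ ℓ o)) (cong length sub≡t)
    from : (ℓ ≡ᵇ length t) ∧ isAt s₁ t k₁ ∧ isAt s₂ t k₂ ≡ true →
           isBlock s₁ s₂ k₁ k₂ ℓ ∧ ⌊ sub s₁ k₁ ℓ ≟s t ⌋ ≡ true
    from h with ∧³-true (ℓ ≡ᵇ length t) (isAt s₁ t k₁) h
    ... | ℓ≡ᵇ∣t∣ , a₁ , a₂ =
      subst (λ m → isBlock s₁ s₂ k₁ k₂ m ∧ ⌊ sub s₁ k₁ m ≟s t ⌋ ≡ true)
            (sym (ℕ.≡ᵇ⇒≡ ℓ (length t) (Equivalence.from T-≡ ℓ≡ᵇ∣t∣)))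
            (cong₂ _∧_ block (⌊⌋-true (sub s₁ k₁ (length t) ≟s t) sub≡t))
      where
      sub≡t : sub s₁ k₁ (length t) ≡ t
      sub≡t = proj₂ (isAt⁻ s₁ t k₁ a₁)
      block : isBlock s₁ s₂ k₁ k₂ (length t) ≡ true
      block = trans (isBlock-decomp₁ k₁ k₂ (length t))
                (subst (λ u → occ s₁ k₁ (length t) ∧ inT s₁ s₂ u ∧ isAt s₂ u k₂ ≡ true) (sym sub≡t)
                  (cong₂ _∧_ (proj₁ (isAt⁻ s₁ t k₁ a₁))
                             (cong₂ _∧_ (isAt⇒inT s₁ s₂ t k₁ k₂ a₁ a₂) a₂)))

  module _ (X : Str σ → ℕ → ℕ → ℚ) where

    cover-summand₁ : ∀ c k₁ k₂ ℓ →
      (if isBlock s₁ s₂ k₁ k₂ ℓ then (if c then X (sub s₁ k₁ ℓ) k₁ k₂ else 0ℚ) else 0ℚ) ≡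
      (if occ s₁ k₁ ℓ ∧ inT s₁ s₂ (sub s₁ k₁ ℓ) ∧ c
         then (if isAt s₂ (sub s₁ k₁ ℓ) k₂ then X (sub s₁ k₁ ℓ) k₁ k₂ else 0ℚ) else 0ℚ)
    cover-summand₁ c k₁ k₂ ℓ =
      trans (cong (λ b → if b then _ else 0ℚ) (isBlock-decomp₁ k₁ k₂ ℓ))
            (if-∧-swap (occ s₁ k₁ ℓ) (inT s₁ s₂ (sub s₁ k₁ ℓ)) (isAt s₂ (sub s₁ k₁ ℓ) k₂) c)

    cover-summand₂ : ∀ c k₁ k₂ ℓ →
      (if isBlock s₁ s₂ k₁ k₂ ℓ then (if c then X (sub s₁ k₁ ℓ) k₁ k₂ else 0ℚ) else 0ℚ) ≡
      (if occ s₂ k₂ ℓ ∧ inT s₁ s₂ (sub s₂ k₂ ℓ) ∧ c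
         then (if isAt s₁ (sub s₂ k₂ ℓ) k₁ then X (sub s₂ k₂ ℓ) k₁ k₂ else 0ℚ) else 0ℚ)
    cover-summand₂ c k₁ k₂ ℓ =
      trans (cong (λ b → if b then _ else 0ℚ) (isBlock-decomp₂ k₁ k₂ ℓ))
            (trans (if-∧-swap (occ s₂ k₂ ℓ) (inT s₁ s₂ t) (isAt s₁ t k₁) c)
                   (if-cong λ g → if-cong λ a₁ → cong (λ u → X u k₁ k₂) (sub≡ g a₁)))
      where
      t : Str σ
      t = sub s₂ k₂ ℓ
      sub≡ : occ s₂ k₂ ℓ ∧ inT s₁ s₂ t ∧ c ≡ true → isAt s₁ t k₁ ≡ true → sub s₁ k₁ ℓ ≡ t
      sub≡ g a₁ = subst (λ m → sub s₁ k₁ m ≡ t) (length-sub s₂ k₂ ℓ (∧-conicalˡ (occ s₂ k₂ ℓ) _ g))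
                        (proj₂ (isAt⁻ s₁ t k₁ a₁))

    π-summand : ∀ t c k₁ k₂ ℓ →
      (if isBlock s₁ s₂ k₁ k₂ ℓ
         then (if ⌊ sub s₁ k₁ ℓ ≟s t ⌋ ∧ c then X (sub s₁ k₁ ℓ) k₁ k₂ else 0ℚ) else 0ℚ) ≡
      (if c then (if ℓ ≡ᵇ length t
                    then (if isAt s₁ t k₁ ∧ isAt s₂ t k₂ then X t k₁ k₂ else 0ℚ) else 0ℚ) else 0ℚ)
    π-summand t c k₁ k₂ ℓ = begin
      (if B then (if u ∧ c then X (sub s₁ k₁ ℓ) k₁ k₂ else 0ℚ) else 0ℚ)
        ≡⟨ cong (λ v → if B then v else 0ℚ) (if-cong λ u∧c → cong (λ v → X v k₁ k₂) (sub≡t u∧c)) ⟩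
      (if B then (if u ∧ c then X t k₁ k₂ else 0ℚ) else 0ℚ)
        ≡⟨ if-∧-float B u c ⟩
      (if c then (if B ∧ u then X t k₁ k₂ else 0ℚ) else 0ℚ)
        ≡⟨ cong (λ b → if c then (if b then X t k₁ k₂ else 0ℚ) else 0ℚ) (isBlock∧≟ t k₁ k₂ ℓ) ⟩
      (if c then (if (ℓ ≡ᵇ length t) ∧ isAt s₁ t k₁ ∧ isAt s₂ t k₂ then X t k₁ k₂ else 0ℚ) else 0ℚ)
        ≡⟨ cong (λ v → if c then v else 0ℚ) (if-∧ (ℓ ≡ᵇ length t)) ⟩
      (if c then (if ℓ ≡ᵇ length t
                    then (if isAt s₁ t k₁ ∧ isAt s₂ t k₂ then X t k₁ k₂ else 0ℚ) else 0ℚ) else 0ℚ)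
      ∎
      where
      open ≡-Reasoning
      B : Bool
      B = isBlock s₁ s₂ k₁ k₂ ℓ
      u : Bool
      u = ⌊ sub s₁ k₁ ℓ ≟s t ⌋
      sub≡t : u ∧ c ≡ true → sub s₁ k₁ ℓ ≡ t
      sub≡t u∧c = toWitness (Equivalence.from T-≡ (∧-conicalˡ u c u∧c))

-- Related strings have equal length

module FinSum = CommutativeMonoidSum ℕ.+-0-commutativeMonoid

δ : Fin σ → Fin σ → ℕ
δ c a = if does (c Fin.≟ a) then 1 else 0

∑-δ : ∀ (c : Fin σ) → FinSum.sum (δ c) ≡ 1
∑-δ {suc σ} Fin.zero    = cong suc (FinSum.sum-replicate-zero σ)
∑-δ {suc σ} (Fin.suc c) = ∑-δ c

count-∷ : ∀ (c : Fin σ) s a → count a (c ∷ s) ≡ δ c a ℕ.+ count a s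
count-∷ c s a with c Fin.≟ a
... | yes _ = refl
... | no  _ = refl

∑-count : ∀ (s : Str σ) → FinSum.sum (λ a → count a s) ≡ length s
∑-count {σ} []      = FinSum.sum-replicate-zero σ
∑-count     (c ∷ s) = begin
  FinSum.sum (λ a → count a (c ∷ s))                  ≡⟨ FinSum.sum-cong-≗ (count-∷ c s) ⟩
  FinSum.sum (λ a → δ c a ℕ.+ count a s)              ≡⟨ FinSum.∑-distrib-+ (δ c) (λ a → count a s) ⟩
  FinSum.sum (δ c) ℕ.+ FinSum.sum (λ a → count a s)   ≡⟨ cong₂ ℕ._+_ (∑-δ c) (∑-count s) ⟩
  suc (length s)                                      ∎
  where open ≡-Reasoning

Related⇒length≡ : ∀ (s₁ s₂ : Str σ) → Related s₁ s₂ → length s₂ ≡ length s₁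
Related⇒length≡ s₁ s₂ rel = begin
  length s₂                          ≡⟨ ∑-count s₂ ⟨
  FinSum.sum (λ a → count a s₂)      ≡⟨ FinSum.sum-cong-≗ (λ a → sym (rel a)) ⟩
  FinSum.sum (λ a → count a s₁)      ≡⟨ ∑-count s₁ ⟩
  length s₁                          ∎
  where open ≡-Reasoning

-- Lifting a feasible solution of LP_cs

module Lift (s₁ s₂ : Str σ) (len₂ : length s₂ ≡ length s₁) (y₁ y₂ : Str σ → ℕ → ℚ)
  (mass : ∀ t → inT s₁ s₂ t ≡ true → sumQ s₁ t y₁ ≡ sumQ s₂ t y₂)
  (bounds₁ : ∀ t k → inT s₁ s₂ t ≡ true → isAt s₁ t k ≡ true → 0ℚ ≤ y₁ t k × y₁ t k ≤ 1ℚ)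
  (bounds₂ : ∀ t k → inT s₁ s₂ t ≡ true → isAt s₂ t k ≡ true → 0ℚ ≤ y₂ t k × y₂ t k ≤ 1ℚ)
  where

  n : ℕ
  n = length s₁

  Y₁ Y₂ : Str σ → ℕ → ℚ
  Y₁ t k = if isAt s₁ t k then y₁ t k else 0ℚ
  Y₂ t k = if isAt s₂ t k then y₂ t k else 0ℚ

  X : Str σ → ℕ → ℕ → ℚ
  X t = coupling (y₁ t) (y₂ t) (sumQ s₁ t y₁)

  x : ℕ → ℕ → ℕ → ℚ
  x k₁ k₂ ℓ = X (sub s₁ k₁ ℓ) k₁ k₂

  isAt₁⇒∈pos : ∀ t k → isAt s₁ t k ≡ true → k ∈ pos n × length t ∈ pos n
  isAt₁⇒∈pos t k a = occ⇒∈pos s₁ k (length t) (proj₁ (isAt⁻ s₁ t k a))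

  isAt₂⇒∈pos : ∀ t k → isAt s₂ t k ≡ true → k ∈ pos n × length t ∈ pos n
  isAt₂⇒∈pos t k a =
    subst (λ m → k ∈ pos m × length t ∈ pos m) len₂ (occ⇒∈pos s₂ k (length t) (proj₁ (isAt⁻ s₂ t k a)))

  Y₁-nonNeg : ∀ {t} → inT s₁ s₂ t ≡ true → ∀ k → 0ℚ ≤ Y₁ t k
  Y₁-nonNeg {t} i k with isAt s₁ t k in a
  ... | true  = proj₁ (bounds₁ t k i a)
  ... | false = ℚ.≤-refl

  Y₂-nonNeg : ∀ {t} → inT s₁ s₂ t ≡ true → ∀ k → 0ℚ ≤ Y₂ t k
  Y₂-nonNeg {t} i k with isAt s₂ t k in a
  ... | true  = proj₁ (bounds₂ t k i a)
  ... | false = ℚ.≤-refl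

  mass₂ : ∀ {t} → inT s₁ s₂ t ≡ true → sumQ s₁ t y₁ ≡ ∑ (pos n) (Y₂ t)
  mass₂ {t} i = trans (mass t i) (cong (λ m → ∑ (pos m) (Y₂ t)) len₂)

  y₁-vanishes : ∀ {t k} → inT s₁ s₂ t ≡ true → isAt s₁ t k ≡ true → sumQ s₁ t y₁ ≡ 0ℚ → y₁ t k ≡ 0ℚ
  y₁-vanishes {t} {k} i a S≡0 =
    trans (sym (if-true a)) (∑≡0⇒≡0 (Y₁-nonNeg i) (proj₁ (isAt₁⇒∈pos t k a)) S≡0)

  y₂-vanishes : ∀ {t k} → inT s₁ s₂ t ≡ true → isAt s₂ t k ≡ true → sumQ s₁ t y₁ ≡ 0ℚ → y₂ t k ≡ 0ℚ
  y₂-vanishes {t} {k} i a S≡0 =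
    trans (sym (if-true a)) (∑≡0⇒≡0 (Y₂-nonNeg i) (proj₁ (isAt₂⇒∈pos t k a)) (trans (sym (mass₂ i)) S≡0))

  row-marginal : ∀ {t k₁} → inT s₁ s₂ t ≡ true → isAt s₁ t k₁ ≡ true →
                 ∑ (pos n) (λ k₂ → if isAt s₂ t k₂ then X t k₁ k₂ else 0ℚ) ≡ y₁ t k₁
  row-marginal {t} {k₁} i a =
    ∑-coupling-row (pos n) (y₁ t) (y₂ t) (sumQ s₁ t y₁) (isAt s₂ t) k₁ (sym (mass₂ i)) (y₁-vanishes i a)

  col-marginal : ∀ {t k₂} → inT s₁ s₂ t ≡ true → isAt s₂ t k₂ ≡ true →
                 ∑ (pos n) (λ k₁ → if isAt s₁ t k₁ then X t k₁ k₂ else 0ℚ) ≡ y₂ t k₂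
  col-marginal {t} {k₂} i a =
    ∑-coupling-col (pos n) (y₁ t) (y₂ t) (sumQ s₁ t y₁) (isAt s₁ t) k₂ refl (y₂-vanishes i a)

  cover-term₁ : ∀ j k₁ ℓ →
    ∑ (pos n) (λ k₂ → if isBlock s₁ s₂ k₁ k₂ ℓ then (if covers j k₁ ℓ then x k₁ k₂ ℓ else 0ℚ) else 0ℚ) ≡
    (if occ s₁ k₁ ℓ ∧ inT s₁ s₂ (sub s₁ k₁ ℓ) ∧ covers j k₁ ℓ then y₁ (sub s₁ k₁ ℓ) k₁ else 0ℚ)
  cover-term₁ j k₁ ℓ = begin
    ∑ (pos n) (λ k₂ → if isBlock s₁ s₂ k₁ k₂ ℓ then (if covers j k₁ ℓ then x k₁ k₂ ℓ else 0ℚ) else 0ℚ)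
      ≡⟨ ∑-cong (pos n) (λ k₂ → cover-summand₁ s₁ s₂ X (covers j k₁ ℓ) k₁ k₂ ℓ) ⟩
    ∑ (pos n) (λ k₂ → if g then (if isAt s₂ t k₂ then X t k₁ k₂ else 0ℚ) else 0ℚ)
      ≡⟨ ∑-if (pos n) g _ ⟩
    (if g then ∑ (pos n) (λ k₂ → if isAt s₂ t k₂ then X t k₁ k₂ else 0ℚ) else 0ℚ)
      ≡⟨ if-cong {b = g} (λ g≡true → let (o , i , _) = ∧³-true (occ s₁ k₁ ℓ) (inT s₁ s₂ t) g≡true
                                     in row-marginal {t} {k₁} i (isAt-self s₁ k₁ ℓ o)) ⟩
    (if g then y₁ t k₁ else 0ℚ)
    ∎
    where
    open ≡-Reasoning
    t : Str σ
    t = sub s₁ k₁ ℓ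
    g : Bool
    g = occ s₁ k₁ ℓ ∧ inT s₁ s₂ t ∧ covers j k₁ ℓ

  cover-term₂ : ∀ j k₂ ℓ →
    ∑ (pos n) (λ k₁ → if isBlock s₁ s₂ k₁ k₂ ℓ then (if covers j k₂ ℓ then x k₁ k₂ ℓ else 0ℚ) else 0ℚ) ≡
    (if occ s₂ k₂ ℓ ∧ inT s₁ s₂ (sub s₂ k₂ ℓ) ∧ covers j k₂ ℓ then y₂ (sub s₂ k₂ ℓ) k₂ else 0ℚ)
  cover-term₂ j k₂ ℓ = begin
    ∑ (pos n) (λ k₁ → if isBlock s₁ s₂ k₁ k₂ ℓ then (if covers j k₂ ℓ then x k₁ k₂ ℓ else 0ℚ) else 0ℚ)
      ≡⟨ ∑-cong (pos n) (λ k₁ → cover-summand₂ s₁ s₂ X (covers j k₂ ℓ) k₁ k₂ ℓ) ⟩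
    ∑ (pos n) (λ k₁ → if g then (if isAt s₁ t k₁ then X t k₁ k₂ else 0ℚ) else 0ℚ)
      ≡⟨ ∑-if (pos n) g _ ⟩
    (if g then ∑ (pos n) (λ k₁ → if isAt s₁ t k₁ then X t k₁ k₂ else 0ℚ) else 0ℚ)
      ≡⟨ if-cong {b = g} (λ g≡true → let (o , i , _) = ∧³-true (occ s₂ k₂ ℓ) (inT s₁ s₂ t) g≡true
                                     in col-marginal {t} {k₂} i (isAt-self s₂ k₂ ℓ o)) ⟩
    (if g then y₂ t k₂ else 0ℚ)
    ∎
    where
    open ≡-Reasoning
    t : Str σ
    t = sub s₂ k₂ ℓ
    g : Bool
    g = occ s₂ k₂ ℓ ∧ inT s₁ s₂ t ∧ covers j k₂ ℓ

  cover₁-x≡y : ∀ j → sumB s₁ s₂ (λ k₁ k₂ ℓ → if covers j k₁ ℓ then x k₁ k₂ ℓ else 0ℚ) ≡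
                     coverCS s₁ s₂ s₁ y₁ j
  cover₁-x≡y j = ∑-cong (pos n) λ k₁ →
    trans (∑-comm (pos n) (pos n) _) (∑-cong (pos n) (cover-term₁ j k₁))

  cover₂-x≡y : ∀ j → sumB s₁ s₂ (λ k₁ k₂ ℓ → if covers j k₂ ℓ then x k₁ k₂ ℓ else 0ℚ) ≡
                     coverCS s₁ s₂ s₂ y₂ j
  cover₂-x≡y j = begin
    ∑ (pos n) (λ k₁ → ∑ (pos n) (λ k₂ → ∑ (pos n) (summand k₁ k₂)))
      ≡⟨ ∑-comm (pos n) (pos n) (λ k₁ k₂ → ∑ (pos n) (summand k₁ k₂)) ⟩
    ∑ (pos n) (λ k₂ → ∑ (pos n) (λ k₁ → ∑ (pos n) (summand k₁ k₂)))
      ≡⟨ ∑-cong (pos n) (λ k₂ → trans (∑-comm (pos n) (pos n) (λ k₁ → summand k₁ k₂))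
                                       (∑-cong (pos n) (cover-term₂ j k₂))) ⟩
    ∑ (pos n) (λ k → ∑ (pos n) (term k))
      ≡⟨ cong (λ m → ∑ (pos m) (λ k → ∑ (pos m) (term k))) len₂ ⟨
    coverCS s₁ s₂ s₂ y₂ j
    ∎
    where
    open ≡-Reasoning
    summand : ℕ → ℕ → ℕ → ℚ
    summand k₁ k₂ ℓ = if isBlock s₁ s₂ k₁ k₂ ℓ then (if covers j k₂ ℓ then x k₁ k₂ ℓ else 0ℚ) else 0ℚ
    term : ℕ → ℕ → ℚ
    term k ℓ = if occ s₂ k ℓ ∧ inT s₁ s₂ (sub s₂ k ℓ) ∧ covers j k ℓ then y₂ (sub s₂ k ℓ) k else 0ℚ

  π₁-x≡y₁ : ∀ t k → inT s₁ s₂ t ≡ true → isAt s₁ t k ≡ true → π₁ s₁ s₂ x t k ≡ y₁ t k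
  π₁-x≡y₁ t k i a = begin
    π₁ s₁ s₂ x t k
      ≡⟨ ∑-cong (pos n) (λ k₁ → ∑-cong (pos n) λ k₂ → ∑-cong (pos n) λ ℓ →
           π-summand s₁ s₂ X t (k₁ ≡ᵇ k) k₁ k₂ ℓ) ⟩
    ∑ (pos n) (λ k₁ → ∑ (pos n) λ k₂ → ∑ (pos n) λ ℓ → if k₁ ≡ᵇ k then G k₁ k₂ ℓ else 0ℚ)
      ≡⟨ ∑-cong (pos n) (λ k₁ → trans (∑-cong (pos n) λ k₂ → ∑-if (pos n) (k₁ ≡ᵇ k) (G k₁ k₂))
                                       (∑-if (pos n) (k₁ ≡ᵇ k) _)) ⟩
    ∑ (pos n) (λ k₁ → if k₁ ≡ᵇ k then ∑ (pos n) (λ k₂ → ∑ (pos n) (G k₁ k₂)) else 0ℚ)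
      ≡⟨ ∑-≡ᵇ _ (pos-unique n) (proj₁ (isAt₁⇒∈pos t k a)) ⟩
    ∑ (pos n) (λ k₂ → ∑ (pos n) (G k k₂))
      ≡⟨ ∑-cong (pos n) (λ k₂ → ∑-≡ᵇ _ (pos-unique n) (proj₂ (isAt₁⇒∈pos t k a))) ⟩
    ∑ (pos n) (λ k₂ → if isAt s₁ t k ∧ isAt s₂ t k₂ then X t k k₂ else 0ℚ)
      ≡⟨ ∑-cong (pos n) (λ k₂ → cong (λ b → if b ∧ isAt s₂ t k₂ then X t k k₂ else 0ℚ) a) ⟩
    ∑ (pos n) (λ k₂ → if isAt s₂ t k₂ then X t k k₂ else 0ℚ)
      ≡⟨ row-marginal i a ⟩
    y₁ t k
    ∎
    where
    open ≡-Reasoning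
    G : ℕ → ℕ → ℕ → ℚ
    G k₁ k₂ ℓ = if ℓ ≡ᵇ length t then (if isAt s₁ t k₁ ∧ isAt s₂ t k₂ then X t k₁ k₂ else 0ℚ) else 0ℚ

  π₂-x≡y₂ : ∀ t k → inT s₁ s₂ t ≡ true → isAt s₂ t k ≡ true → π₂ s₁ s₂ x t k ≡ y₂ t k
  π₂-x≡y₂ t k i a = begin
    π₂ s₁ s₂ x t k
      ≡⟨ ∑-cong (pos n) (λ k₁ → ∑-cong (pos n) λ k₂ → ∑-cong (pos n) λ ℓ →
           π-summand s₁ s₂ X t (k₂ ≡ᵇ k) k₁ k₂ ℓ) ⟩
    ∑ (pos n) (λ k₁ → ∑ (pos n) λ k₂ → ∑ (pos n) λ ℓ → if k₂ ≡ᵇ k then G k₁ k₂ ℓ else 0ℚ)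
      ≡⟨ ∑-cong (pos n) (λ k₁ → ∑-cong (pos n) λ k₂ → ∑-if (pos n) (k₂ ≡ᵇ k) (G k₁ k₂)) ⟩
    ∑ (pos n) (λ k₁ → ∑ (pos n) λ k₂ → if k₂ ≡ᵇ k then ∑ (pos n) (G k₁ k₂) else 0ℚ)
      ≡⟨ ∑-cong (pos n) (λ k₁ → ∑-≡ᵇ _ (pos-unique n) (proj₁ (isAt₂⇒∈pos t k a))) ⟩
    ∑ (pos n) (λ k₁ → ∑ (pos n) (G k₁ k))
      ≡⟨ ∑-cong (pos n) (λ k₁ → ∑-≡ᵇ _ (pos-unique n) (proj₂ (isAt₂⇒∈pos t k a))) ⟩
    ∑ (pos n) (λ k₁ → if isAt s₁ t k₁ ∧ isAt s₂ t k then X t k₁ k else 0ℚ)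
      ≡⟨ ∑-cong (pos n) (λ k₁ → cong (λ b → if b then X t k₁ k else 0ℚ)
                                      (trans (cong (isAt s₁ t k₁ ∧_) a) (∧-identityʳ _))) ⟩
    ∑ (pos n) (λ k₁ → if isAt s₁ t k₁ then X t k₁ k else 0ℚ)
      ≡⟨ col-marginal i a ⟩
    y₂ t k
    ∎
    where
    open ≡-Reasoning
    G : ℕ → ℕ → ℕ → ℚ
    G k₁ k₂ ℓ = if ℓ ≡ᵇ length t then (if isAt s₁ t k₁ ∧ isAt s₂ t k₂ then X t k₁ k₂ else 0ℚ) else 0ℚ

  x-bounds : ∀ k₁ k₂ ℓ → isBlock s₁ s₂ k₁ k₂ ℓ ≡ true → 0ℚ ≤ x k₁ k₂ ℓ × x k₁ k₂ ℓ ≤ 1ℚ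
  x-bounds k₁ k₂ ℓ b with ∧³-true (occ s₁ k₁ ℓ) (inT s₁ s₂ (sub s₁ k₁ ℓ))
                                 (trans (sym (isBlock-decomp₁ s₁ s₂ k₁ k₂ ℓ)) b)
  ... | o , i , a₂ = let (y₁≥0 , y₁≤1) = bounds₁ t k₁ i (isAt-self s₁ k₁ ℓ o) in
                     *-inv₀-bounds y₁≥0 y₁≤1 (proj₁ (bounds₂ t k₂ i a₂)) y₂≤S
    where
    t : Str σ
    t = sub s₁ k₁ ℓ
    y₂≤S : y₂ t k₂ ≤ sumQ s₁ t y₁
    y₂≤S = begin
      y₂ t k₂               ≡⟨ if-true a₂ ⟨
      Y₂ t k₂               ≤⟨ ∈⇒≤∑ (Y₂-nonNeg i) (proj₁ (isAt₂⇒∈pos t k₂ a₂)) ⟩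
      ∑ (pos n) (Y₂ t)      ≡⟨ mass₂ i ⟨
      sumQ s₁ t y₁          ∎
      where open ℚ.≤-Reasoning

lemma2 : ∀ {σ : ℕ} (s₁ s₂ : Str σ) → Related s₁ s₂ →
    ∀ (y₁ y₂ : Str σ → ℕ → ℚ) → FeasibleCS s₁ s₂ y₁ y₂ →
    ∃ λ (x : ℕ → ℕ → ℕ → ℚ) → FeasibleCB s₁ s₂ x ×
      (∀ t k → inT s₁ s₂ t ≡ true → isAt s₁ t k ≡ true → π₁ s₁ s₂ x t k ≡ y₁ t k) ×
      (∀ t k → inT s₁ s₂ t ≡ true → isAt s₂ t k ≡ true → π₂ s₁ s₂ x t k ≡ y₂ t k)
lemma2 s₁ s₂ related y₁ y₂ (cover₁ , cover₂ , mass , bounds₁ , bounds₂) =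
  x , ( (λ j j≥1 j≤n → trans (cover₁-x≡y j) (cover₁ j j≥1 j≤n))
      , (λ j j≥1 j≤n → trans (cover₂-x≡y j) (cover₂ j j≥1 j≤n))
      , x-bounds )
    , π₁-x≡y₁ , π₂-x≡y₂
  where open Lift s₁ s₂ (Related⇒length≡ s₁ s₂ related) y₁ y₂ mass bounds₁ bounds₂
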